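{- If $A\subseteq\mathbb{N}$ is a $J_p$-set and $n\in\mathbb{N}$, then $n\cdot A=\{na: a\in A\}$ is a $J_p$-set.
   Context: $\mathbb{P}$ denotes the set of polynomials with integer coefficients which vanish at $0$ and map $\mathbb{N}$ into $\mathbb{N}$. An IP-set is a family $(x_\alpha)_\alpha$ indexed by nonempty finite $\alpha\subseteq\mathbb{N}$ with $x_\alpha=\sum_{t\in\alpha}x_t$ for some sequence $(x_n)$ in $\mathbb{N}$. $A\subseteq\mathbb{N}$ is a $J_p$-set if for every finite $F\subseteq\mathbb{P}$, every $l\in\mathbb{N}$ and all IP-sets $(x^i_\alpha)_\alpha$, $i=1,\dots,l$, there exist $a\in\mathbb{N}\cup\{0\}$ and nonempty finite $\beta\subseteq\mathbb{N}$ with $a+P(x^i_\beta)\in A$ for all $P\in F$, $i\le l$. -}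

module Defs where

open import Data.Nat using (ℕ; zero; suc; _+_; _*_; _≥_)
open import Data.Integer as ℤ using (ℤ; +_; +<+)
open import Data.List using (List; []; _∷_; map)
open import Data.Nat.ListAction using (sum)
open import Data.List.Relation.Unary.All using (All)
open import Data.List.Relation.Unary.Unique.Propositional using (Unique)
open import Data.List.Membership.Propositional using (_∈_)
open import Data.Fin using (Fin)
open import Data.Product using (Σ; ∃; _×_; _,_)
open import Relation.Binary.PropositionalEquality using (_≡_)

-- Convention: ℕ of the paper = {1,2,3,...}; represented as Agda ℕ with a
-- positivity side condition where needed.  Subsets of ℕ are predicates.
Subset : Set₁
Subset = ℕ → Set

_·_ : ℕ → Subset → Subset
(n · A) m = Σ ℕ λ a → A a × m ≡ n * a

-- Integer polynomials as coefficient lists [c₀, c₁, c₂, ...] (c₀ + c₁ X + ...).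
Poly : Set
Poly = List ℤ

eval : Poly → ℤ → ℤ
eval []       x = + 0
eval (c ∷ cs) x = c ℤ.+ x ℤ.* eval cs x

record InP (P : Poly) : Set where
  field
    vanishes-at-0 : eval P (+ 0) ≡ + 0
    maps-ℕ-to-ℕ   : ∀ (m : ℕ) → m ≥ 1 → Σ ℕ λ k → k ≥ 1 × eval P (+ m) ≡ + k

PolyP : Set
PolyP = Σ Poly InP

-- An IP-set is generated by a sequence (x_n) in ℕ (positive values);
-- the index set ℕ is represented by Agda ℕ (the shift is immaterial).
Seq : Set
Seq = Σ (ℕ → ℕ) λ x → ∀ t → x t ≥ 1

record FinSet⁺ : Set where
  constructor fin⁺
  field
    elems  : List ℕ
    unique : Unique elems
    nonempty : Σ ℕ λ t → t ∈ elems

IPsum : Seq → FinSet⁺ → ℕ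
IPsum (x , _) β = sum (map x (FinSet⁺.elems β))

IsJp : Subset → Set
IsJp A =
  (F : List PolyP) (l : ℕ) (xs : Fin l → Seq) →
  Σ ℕ λ a → Σ FinSet⁺ λ β →
    ∀ (i : Fin l) → All (λ P → Σ ℕ λ m → A m × + m ≡ + a ℤ.+ eval (Data.Product.proj₁ P) (+ IPsum (xs i) β)) F

-- Fix n ≥ 1. Pigeonhole on prefix sums modulo n shows that every IP-set has a sum
-- subsystem, taken along consecutive blocks of indices, whose block sums are all
-- divisible by n; refining the blocks once per IP-set handles all l of them at once.
-- Dividing by n gives IP-sets y⁽ⁱ⁾ with x⁽ⁱ⁾ summed over the blocks indexed by β equal
-- to n · y⁽ⁱ⁾_β. For P ∈ ℙ the polynomial P(nX)/n is again in ℙ, so the J_p-property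
-- of A applied to these polynomials and the y⁽ⁱ⁾ gives a with a + P(n y⁽ⁱ⁾_β)/n ∈ A;
-- multiplying by n puts n a + P(x⁽ⁱ⁾) into n · A.

{-# OPTIONS --safe #-}
module Submission where

open import Defs
open import Data.Nat using (ℕ; _≥_; zero; suc; _+_; _*_; _≤_; _<_; s≤s; z≤n; s≤s⁻¹; NonZero; >-nonZero; >-nonZero⁻¹)
open import Data.Nat.Properties
open import Data.Nat.Divisibility using (_∣_; divides; ∣m+n∣m⇒∣n; ∣m∣n⇒∣m+n; quotient≢0; m∣n⇒n≡m*quotient)
open import Data.Nat.DivMod using (_%_; _/_; m≡m%n+[m/n]*n; m%n<n; %-congˡ)
open import Data.Nat.ListAction using (sum)
open import Data.Nat.ListAction.Properties using (sum-++)
open import Data.Integer as ℤ using (ℤ; +_; -[1+_])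
import Data.Integer.Properties as ℤ
open import Data.Integer.Tactic.RingSolver using (solve-∀)
open import Data.List using (List; []; _∷_; _++_; map; concatMap)
open import Data.List.Properties using (map-++; map-cong)
open import Data.List.Relation.Unary.All as All using (All)
import Data.List.Relation.Unary.All.Properties as All
open import Data.List.Relation.Unary.Any using (here; there)
import Data.List.Relation.Unary.AllPairs as AllPairs
import Data.List.Relation.Unary.AllPairs.Properties as AllPairs
open import Data.List.Relation.Unary.Unique.Propositional using (Unique)
import Data.List.Relation.Unary.Unique.Propositional.Properties as Unique
open import Data.List.Membership.Propositional using (_∈_; find; lose)
open import Data.List.Membership.Propositional.Properties using (∈-concatMap⁺; ∈-concatMap⁻)
open import Data.Fin as Fin using (Fin; toℕ; fromℕ<)
open import Data.Fin.Properties using (pigeonhole; fromℕ<-injective)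
open import Data.Product using (Σ; ∃; ∃₂; _×_; _,_; proj₁; proj₂)
open import Data.Sum using (inj₁; inj₂)
open import Data.Empty using (⊥)
open import Relation.Nullary using (¬_)
open import Relation.Binary using (tri<; tri≈; tri>)
open import Relation.Binary.PropositionalEquality

interval : ℕ → ℕ → List ℕ
interval a zero    = []
interval a (suc k) = a ∷ interval (suc a) k

∈-interval⁻ : ∀ a k {e} → e ∈ interval a k → a ≤ e × e < a + k
∈-interval⁻ a (suc k) (here refl) = ≤-refl , m<m+n a (s≤s z≤n)
∈-interval⁻ a (suc k) {e} (there e∈)
  with a<e , e<a+1+k ← ∈-interval⁻ (suc a) k e∈
  = <⇒≤ a<e , subst (e <_) (sym (+-suc a k)) e<a+1+k

interval-unique : ∀ a k → Unique (interval a k)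
interval-unique a zero    = AllPairs.[]
interval-unique a (suc k) =
  All.tabulate (λ e∈ a≡e → <-irrefl a≡e (proj₁ (∈-interval⁻ (suc a) k e∈)))
  AllPairs.∷ interval-unique (suc a) k

sum-interval-+ : (y : ℕ → ℕ) → ∀ a j d →
  sum (map y (interval a (j + d))) ≡ sum (map y (interval a j)) + sum (map y (interval (a + j) d))
sum-interval-+ y a zero    d rewrite +-identityʳ a = refl
sum-interval-+ y a (suc j) d rewrite sum-interval-+ y (suc a) j d | +-suc a j = sym (+-assoc (y a) _ _)

%-≡⇒∣ : ∀ {N} .{{_ : NonZero N}} m d → m % N ≡ (m + d) % N → N ∣ d
%-≡⇒∣ {N} m d same = ∣m+n∣m⇒∣n (divides ((m + d) / N) cancelled) (divides (m / N) refl)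
  where
  open ≡-Reasoning
  cancelled : m / N * N + d ≡ (m + d) / N * N
  cancelled = +-cancelˡ-≡ (m % N) _ _ (begin
    m % N + (m / N * N + d)       ≡⟨ sym (+-assoc (m % N) _ d) ⟩
    m % N + m / N * N + d         ≡⟨ cong (_+ d) (sym (m≡m%n+[m/n]*n m N)) ⟩
    m + d                         ≡⟨ m≡m%n+[m/n]*n (m + d) N ⟩
    (m + d) % N + (m + d) / N * N ≡⟨ cong (_+ (m + d) / N * N) (sym same) ⟩
    m % N + (m + d) / N * N       ∎)

-- Of the N + 1 prefix sums of y from u on, two agree modulo N.
divisibleIntervalFrom : ∀ N .{{_ : NonZero N}} (y : ℕ → ℕ) u →
  ∃₂ λ a k → u ≤ a × N ∣ sum (map y (interval a (suc k)))
divisibleIntervalFrom N y u = fromCollision (pigeonhole (n<1+n N) remainder)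
  where
  open ≡-Reasoning
  prefix : ℕ → ℕ
  prefix k = sum (map y (interval u k))
  remainder : Fin (suc N) → Fin N
  remainder k = fromℕ< (m%n<n (prefix (toℕ k)) N)
  fromCollision : ∃₂ (λ i j → i Fin.< j × remainder i ≡ remainder j) →
                  ∃₂ λ a k → u ≤ a × N ∣ sum (map y (interval a (suc k)))
  fromCollision (i , j , i<j , same) with o , i+1+o≡j ← m≤n⇒∃[o]m+o≡n i<j
    = u + toℕ i , o , m≤m+n u (toℕ i) , %-≡⇒∣ (prefix (toℕ i)) _ (begin
      prefix (toℕ i) % N           ≡⟨ fromℕ<-injective _ _ (m%n<n _ N) (m%n<n _ N) same ⟩
      prefix (toℕ j) % N           ≡⟨ cong (λ k → prefix k % N) (trans (sym i+1+o≡j) (sym (+-suc (toℕ i) o))) ⟩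
      prefix (toℕ i + suc o) % N   ≡⟨ %-congˡ (sum-interval-+ y u (toℕ i) (suc o)) ⟩
      (prefix (toℕ i) + sum (map y (interval (u + toℕ i) (suc o)))) % N ∎)

incr⇒mono : (f : ℕ → ℕ) → (∀ n → f n < f (suc n)) → ∀ {m n} → m ≤ n → f m ≤ f n
incr⇒mono f inc {n = zero}  z≤n = ≤-refl
incr⇒mono f inc {n = suc n} m≤1+n with m≤n⇒m<n∨m≡n m≤1+n
... | inj₁ m<1+n = ≤-trans (incr⇒mono f inc (s≤s⁻¹ m<1+n)) (<⇒≤ (inc n))
... | inj₂ refl  = ≤-refl

-- Blocks B₀ < B₁ < ⋯ of indices; an IP-set x yields the sum subsystem t ↦ x_{B_t}.
record Blocks : Set where
  field
    block    : ℕ → List ℕ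
    bound    : ℕ → ℕ
    unique   : ∀ t → Unique (block t)
    nonempty : ∀ t → ∃ (_∈ block t)
    between  : ∀ t {e} → e ∈ block t → bound t ≤ e × e < bound (suc t)

open Blocks

bound-mono : (b : Blocks) → ∀ {t t'} → t ≤ t' → bound b t ≤ bound b t'
bound-mono b = incr⇒mono (bound b) bound-<
  where
  bound-< : ∀ t → bound b t < bound b (suc t)
  bound-< t with e , e∈ ← nonempty b t with lo , hi ← between b t e∈ = ≤-<-trans lo hi

blocks-disjoint : (b : Blocks) → ∀ {t t' e} → t < t' → e ∈ block b t → e ∈ block b t' → ⊥
blocks-disjoint b {t} {t'} t<t' e∈t e∈t' =
  <-irrefl refl (<-≤-trans (proj₂ (between b t e∈t))
                           (≤-trans (bound-mono b t<t') (proj₁ (between b t' e∈t'))))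

blockUnion : Blocks → List ℕ → List ℕ
blockUnion b = concatMap (block b)

∈-blockUnion⁻ : (b : Blocks) → ∀ {L e} → e ∈ blockUnion b L → ∃ λ t → t ∈ L × e ∈ block b t
∈-blockUnion⁻ b {L} e∈ = find (∈-concatMap⁻ (block b) {xs = L} e∈)

∈-blockUnion⁺ : (b : Blocks) → ∀ {L t e} → t ∈ L → e ∈ block b t → e ∈ blockUnion b L
∈-blockUnion⁺ b t∈ e∈ = ∈-concatMap⁺ (block b) (lose t∈ e∈)

blockUnion-unique : (b : Blocks) → ∀ {L} → Unique L → Unique (blockUnion b L)
blockUnion-unique b uL =
  Unique.concat⁺ (All.map⁺ (All.tabulate λ {t} _ → unique b t))
                 (AllPairs.map⁺ (AllPairs.map disjoint uL))
  where
  disjoint : ∀ {t t'} → t ≢ t' → ∀ {e} → ¬ (e ∈ block b t × e ∈ block b t')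
  disjoint {t} {t'} t≢t' (e∈t , e∈t') with <-cmp t t'
  ... | tri< t<t' _ _ = blocks-disjoint b t<t' e∈t e∈t'
  ... | tri≈ _ t≡t' _ = t≢t' t≡t'
  ... | tri> _ _ t'<t = blocks-disjoint b t'<t e∈t' e∈t

blockSum : (ℕ → ℕ) → Blocks → ℕ → ℕ
blockSum x b t = sum (map x (block b t))

sum-blockUnion : (x : ℕ → ℕ) (b : Blocks) (L : List ℕ) →
  sum (map x (blockUnion b L)) ≡ sum (map (blockSum x b) L)
sum-blockUnion x b []      = refl
sum-blockUnion x b (t ∷ L) = begin
  sum (map x (block b t ++ blockUnion b L))      ≡⟨ cong sum (map-++ x (block b t) _) ⟩
  sum (map x (block b t) ++ map x (blockUnion b L)) ≡⟨ sum-++ (map x (block b t)) _ ⟩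
  blockSum x b t + sum (map x (blockUnion b L))            ≡⟨ cong (_+_ (blockSum x b t)) (sum-blockUnion x b L) ⟩
  blockSum x b t + sum (map (blockSum x b) L)              ∎
  where open ≡-Reasoning

coarsen : Blocks → Blocks → Blocks
coarsen b c = record
  { block    = λ T → blockUnion b (block c T)
  ; bound    = λ T → bound b (bound c T)
  ; unique   = λ T → blockUnion-unique b (unique c T)
  ; nonempty = nonempty′
  ; between  = between′
  }
  where
  nonempty′ : ∀ T → ∃ (_∈ blockUnion b (block c T))
  nonempty′ T with t , t∈ ← nonempty c T with e , e∈ ← nonempty b t = e , ∈-blockUnion⁺ b t∈ e∈
  between′ : ∀ T {e} → e ∈ blockUnion b (block c T) →
             bound b (bound c T) ≤ e × e < bound b (bound c (suc T))
  between′ T e∈ with t , t∈ , e∈t ← ∈-blockUnion⁻ b e∈ with lo , hi ← between c T t∈ =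
    ≤-trans (bound-mono b lo) (proj₁ (between b t e∈t)) ,
    <-≤-trans (proj₂ (between b t e∈t)) (bound-mono b hi)

singletons : Blocks
singletons = record
  { block    = λ t → t ∷ []
  ; bound    = λ t → t
  ; unique   = λ t → All.[] AllPairs.∷ AllPairs.[]
  ; nonempty = λ t → t , here refl
  ; between  = λ { t (here refl) → ≤-refl , n<1+n t }
  }

divisibleIntervals : ∀ N .{{_ : NonZero N}} (y : ℕ → ℕ) → Σ Blocks λ b → ∀ t → N ∣ blockSum y b t
divisibleIntervals N y = record
  { block    = λ t → interval (start (first t)) (suc (extra (first t)))
  ; bound    = first
  ; unique   = λ t → interval-unique (start (first t)) _
  ; nonempty = λ t → start (first t) , here refl
  ; between  = between′
  } , λ t → proj₂ (proj₂ (proj₂ (divisibleIntervalFrom N y (first t))))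
  where
  start extra : ℕ → ℕ
  start u = proj₁ (divisibleIntervalFrom N y u)
  extra u = proj₁ (proj₂ (divisibleIntervalFrom N y u))
  first : ℕ → ℕ
  first zero    = 0
  first (suc t) = start (first t) + suc (extra (first t))
  between′ : ∀ t {e} → e ∈ interval (start (first t)) (suc (extra (first t))) →
             first t ≤ e × e < first (suc t)
  between′ t e∈ with lo , hi ← ∈-interval⁻ _ _ e∈ =
    ≤-trans (proj₁ (proj₂ (proj₂ (divisibleIntervalFrom N y (first t))))) lo , hi

∣-sum-map : ∀ {N} {f : ℕ → ℕ} L → (∀ t → N ∣ f t) → N ∣ sum (map f L)
∣-sum-map []      _   = divides 0 refl
∣-sum-map (t ∷ L) N∣f = ∣m∣n⇒∣m+n (N∣f t) (∣-sum-map L N∣f)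

divisibleBlocks : ∀ N .{{_ : NonZero N}} l (xs : Fin l → ℕ → ℕ) →
  Σ Blocks λ b → ∀ i t → N ∣ blockSum (xs i) b t
divisibleBlocks N zero    xs = singletons , λ ()
divisibleBlocks N (suc l) xs
  with b , b-div ← divisibleBlocks N l (λ i → xs (Fin.suc i))
  with c , c-div ← divisibleIntervals N (blockSum (xs Fin.zero) b)
  = coarsen b c , coarsen-div
  where
  coarsen-div : ∀ i T → N ∣ blockSum (xs i) (coarsen b c) T
  coarsen-div i T rewrite sum-blockUnion (xs i) b (block c T) with i
  ... | Fin.zero  = c-div T
  ... | Fin.suc i = ∣-sum-map (block c T) (b-div i)

blockUnion⁺ : Blocks → FinSet⁺ → FinSet⁺
blockUnion⁺ b β = fin⁺ (blockUnion b (elems β)) (blockUnion-unique b (FinSet⁺.unique β)) nonempty′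
  where
  open FinSet⁺ using (elems)
  nonempty′ : ∃ (_∈ blockUnion b (elems β))
  nonempty′ with t , t∈ ← FinSet⁺.nonempty β with e , e∈ ← nonempty b t = e , ∈-blockUnion⁺ b t∈ e∈

sum-map-pos : ∀ {x : ℕ → ℕ} → (∀ t → x t ≥ 1) → ∀ {L t} → t ∈ L → sum (map x L) ≥ 1
sum-map-pos pos {t ∷ L} (here refl) = ≤-trans (pos t) (m≤m+n _ _)
sum-map-pos pos {u ∷ L} (there t∈)  = ≤-trans (sum-map-pos pos t∈) (m≤n+m _ _)

quotientSeq : ∀ N (x : Seq) (b : Blocks) → (∀ t → N ∣ blockSum (proj₁ x) b t) →
  Σ Seq λ y → ∀ β → IPsum x (blockUnion⁺ b β) ≡ N * IPsum y β
quotientSeq N (x , x-pos) b div = (y , y-pos) , λ β → begin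
  sum (map x (blockUnion b (FinSet⁺.elems β)))  ≡⟨ sum-blockUnion x b (FinSet⁺.elems β) ⟩
  sum (map (blockSum x b) (FinSet⁺.elems β))    ≡⟨ cong sum (map-cong (λ t → m∣n⇒n≡m*quotient (div t)) (FinSet⁺.elems β)) ⟩
  sum (map (λ t → N * y t) (FinSet⁺.elems β))   ≡⟨ sum-map-*ˡ y (FinSet⁺.elems β) ⟩
  N * sum (map y (FinSet⁺.elems β))             ∎
  where
  open ≡-Reasoning
  y : ℕ → ℕ
  y t = _∣_.quotient (div t)
  y-pos : ∀ t → y t ≥ 1
  y-pos t with e , e∈ ← nonempty b t =
    >-nonZero⁻¹ (y t) {{quotient≢0 (div t) {{>-nonZero (sum-map-pos x-pos e∈)}}}}
  sum-map-*ˡ : (f : ℕ → ℕ) (L : List ℕ) → sum (map (λ t → N * f t) L) ≡ N * sum (map f L)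
  sum-map-*ˡ f []      = sym (*-zeroʳ N)
  sum-map-*ˡ f (t ∷ L) = trans (cong (_+_ (N * f t)) (sum-map-*ˡ f L)) (sym (*-distribˡ-+ N (f t) _))

divisibleSubsystem : ∀ N .{{_ : NonZero N}} l (xs : Fin l → Seq) →
  Σ (FinSet⁺ → FinSet⁺) λ φ → Σ (Fin l → Seq) λ ys →
    ∀ i β → IPsum (xs i) (φ β) ≡ N * IPsum (ys i) β
divisibleSubsystem N l xs with b , b-div ← divisibleBlocks N l (λ i → proj₁ (xs i)) =
  blockUnion⁺ b , (λ i → proj₁ (quotient i)) , (λ i → proj₂ (quotient i))
  where
  quotient : ∀ i → Σ Seq λ y → ∀ β → IPsum (xs i) (blockUnion⁺ b β) ≡ N * IPsum y β
  quotient i = quotientSeq N (xs i) b (b-div i)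

eval-map-* : (k : ℤ) (P : Poly) (z : ℤ) → eval (map (k ℤ.*_) P) z ≡ k ℤ.* eval P z
eval-map-* k []      z = sym (ℤ.*-zeroʳ k)
eval-map-* k (c ∷ P) z = begin
  k ℤ.* c ℤ.+ z ℤ.* eval (map (k ℤ.*_) P) z ≡⟨ cong (λ e → k ℤ.* c ℤ.+ z ℤ.* e) (eval-map-* k P z) ⟩
  k ℤ.* c ℤ.+ z ℤ.* (k ℤ.* eval P z)        ≡⟨ distrib k c z (eval P z) ⟩
  k ℤ.* (c ℤ.+ z ℤ.* eval P z)              ∎
  where
  open ≡-Reasoning
  distrib : ∀ k c z e → k ℤ.* c ℤ.+ z ℤ.* (k ℤ.* e) ≡ k ℤ.* (c ℤ.+ z ℤ.* e)
  distrib = solve-∀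

dilate : ℤ → Poly → Poly
dilate k []       = []
dilate k (c ∷ cs) = c ∷ map (k ℤ.*_) (dilate k cs)

eval-dilate : (k : ℤ) (P : Poly) (z : ℤ) → eval (dilate k P) z ≡ eval P (k ℤ.* z)
eval-dilate k []      z = refl
eval-dilate k (c ∷ P) z = cong (ℤ._+_ c) (begin
  z ℤ.* eval (map (k ℤ.*_) (dilate k P)) z ≡⟨ cong (z ℤ.*_) (eval-map-* k (dilate k P) z) ⟩
  z ℤ.* (k ℤ.* eval (dilate k P) z)        ≡⟨ cong (λ e → z ℤ.* (k ℤ.* e)) (eval-dilate k P z) ⟩
  z ℤ.* (k ℤ.* eval P (k ℤ.* z))           ≡⟨ reassoc z k (eval P (k ℤ.* z)) ⟩
  k ℤ.* z ℤ.* eval P (k ℤ.* z)             ∎)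
  where
  open ≡-Reasoning
  reassoc : ∀ z k e → z ℤ.* (k ℤ.* e) ≡ k ℤ.* z ℤ.* e
  reassoc = solve-∀

-- P(kX)/k, which has integer coefficients when P(0) = 0.
quotDilate : ℤ → Poly → Poly
quotDilate k []       = []
quotDilate k (_ ∷ cs) = + 0 ∷ dilate k cs

eval-quotDilate : (k : ℤ) (P : Poly) → eval P (+ 0) ≡ + 0 →
  ∀ z → eval P (k ℤ.* z) ≡ k ℤ.* eval (quotDilate k P) z
eval-quotDilate k []      _     z = sym (ℤ.*-zeroʳ k)
eval-quotDilate k (c ∷ P) P[0]≡0 z = begin
  c ℤ.+ k ℤ.* z ℤ.* eval P (k ℤ.* z)          ≡⟨ cong₂ (λ c e → c ℤ.+ k ℤ.* z ℤ.* e) c≡0 (sym (eval-dilate k P z)) ⟩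
  + 0 ℤ.+ k ℤ.* z ℤ.* eval (dilate k P) z     ≡⟨ factor k z (eval (dilate k P) z) ⟩
  k ℤ.* (+ 0 ℤ.+ z ℤ.* eval (dilate k P) z)   ∎
  where
  open ≡-Reasoning
  c≡0 : c ≡ + 0
  c≡0 = trans (sym (ℤ.+-identityʳ c)) (trans (cong (ℤ._+_ c) (sym (ℤ.*-zeroˡ (eval P (+ 0))))) P[0]≡0)
  factor : ∀ k z e → + 0 ℤ.+ k ℤ.* z ℤ.* e ≡ k ℤ.* (+ 0 ℤ.+ z ℤ.* e)
  factor = solve-∀

pos*i≡pos⇒i≡pos : ∀ N .{{_ : NonZero N}} q {j} → j ≥ 1 → + N ℤ.* q ≡ + j → Σ ℕ λ i → i ≥ 1 × q ≡ + i
pos*i≡pos⇒i≡pos N (+ zero) j≥1 Nq≡j with () ← ≤-trans j≥1 (≤-reflexive (ℤ.+-injective (trans (sym Nq≡j) (ℤ.*-zeroʳ (+ N)))))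
pos*i≡pos⇒i≡pos N (+ suc i) _ _ = suc i , s≤s z≤n , refl
pos*i≡pos⇒i≡pos (suc N) -[1+ i ] _ ()

quotDilate-InP : ∀ N .{{_ : NonZero N}} {P} → InP P → InP (quotDilate (+ N) P)
quotDilate-InP N {P} P∈ℙ = record { vanishes-at-0 = vanishes P ; maps-ℕ-to-ℕ = positive }
  where
  vanishes : ∀ P → eval (quotDilate (+ N) P) (+ 0) ≡ + 0
  vanishes []       = refl
  vanishes (_ ∷ cs) = trans (ℤ.+-identityˡ _) (ℤ.*-zeroˡ (eval (dilate (+ N) cs) (+ 0)))
  positive : ∀ m → m ≥ 1 → Σ ℕ λ i → i ≥ 1 × eval (quotDilate (+ N) P) (+ m) ≡ + i
  positive m m≥1 with j , j≥1 , P[Nm]≡j ← InP.maps-ℕ-to-ℕ P∈ℙ (N * m) (*-mono-≤ (>-nonZero⁻¹ N) m≥1) =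
    pos*i≡pos⇒i≡pos N _ j≥1 (begin
      + N ℤ.* eval (quotDilate (+ N) P) (+ m) ≡⟨ sym (eval-quotDilate (+ N) P (InP.vanishes-at-0 P∈ℙ) (+ m)) ⟩
      eval P (+ N ℤ.* + m)                    ≡⟨ cong (eval P) (sym (ℤ.pos-* N m)) ⟩
      eval P (+ (N * m))                      ≡⟨ P[Nm]≡j ⟩
      + j                                     ∎)
    where open ≡-Reasoning

scale-witness : ∀ {A : Subset} n (P : PolyP) {a x y} → x ≡ n * y →
  (Σ ℕ λ m → A m × + m ≡ + a ℤ.+ eval (quotDilate (+ n) (proj₁ P)) (+ y)) →
  Σ ℕ λ m → (n · A) m × + m ≡ + (n * a) ℤ.+ eval (proj₁ P) (+ x)
scale-witness n (P , P∈ℙ) {a} {y = y} refl (m , m∈A , m≡a+Q[y]) = n * m , (m , m∈A , refl) , (begin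
  + (n * m)                                                ≡⟨ ℤ.pos-* n m ⟩
  + n ℤ.* + m                                              ≡⟨ cong (ℤ._*_ (+ n)) m≡a+Q[y] ⟩
  + n ℤ.* (+ a ℤ.+ eval (quotDilate (+ n) P) (+ y))        ≡⟨ ℤ.*-distribˡ-+ (+ n) (+ a) _ ⟩
  + n ℤ.* + a ℤ.+ + n ℤ.* eval (quotDilate (+ n) P) (+ y)  ≡⟨ cong₂ ℤ._+_ (sym (ℤ.pos-* n a)) (sym (eval-quotDilate (+ n) P (InP.vanishes-at-0 P∈ℙ) (+ y))) ⟩
  + (n * a) ℤ.+ eval P (+ n ℤ.* + y)                       ≡⟨ cong (λ z → + (n * a) ℤ.+ eval P z) (sym (ℤ.pos-* n y)) ⟩
  + (n * a) ℤ.+ eval P (+ (n * y))                         ∎)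
  where open ≡-Reasoning

corollary2p13 : (A : Subset) → (∀ m → A m → m ≥ 1) → IsJp A →
                (n : ℕ) → n ≥ 1 → IsJp (n · A)
corollary2p13 A _ A-Jp n@(suc _) _ F l xs
  with φ , ys , xs≡n*ys ← divisibleSubsystem n l xs
  with a , β , hit ← A-Jp (map (λ (P , P∈ℙ) → quotDilate (+ n) P , quotDilate-InP n P∈ℙ) F) l ys
  = n * a , φ β , λ i → All.map (λ {P} → scale-witness n P (xs≡n*ys i β)) (All.map⁻ (hit i))
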